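{- Let $n$ be a non-negative integer and $m=\lfloor\frac n6\rfloor+\delta_{4,(n\bmod 6)}$. For each $i\in\{1,\dots,\lfloor\frac n3\rfloor\}$ choose $j_i\in\{2i,\dots,n-i\}$. Then the following set is a generating index set of $\mathcal{DST}_0(n)$: $$G_{D_0}=\{(2i+1,j_{2i+1}): i\in\{0,\dots,m-1\}\}\ \text{ if } n \text{ is even},\qquad G_{D_0}=\{(2i,j_{2i}): i\in\{1,\dots,m\}\}\ \text{ if } n \text{ is odd}.$$
   Context: A binary Steinhaus triangle of size $n$ is an array $(a_{i,j})_{1\le i\le j\le n}$ of elements of $\{0,1\}$ with $a_{i,j}\equiv a_{i-1,j-1}+a_{i-1,j}\pmod 2$ for $2\le i\le j\le n$. $\nabla S$ is the triangle with first row $S$, and these triangles form a vector space over $\mathbb{Z}/2\mathbb{Z}$. The rotation is $r((a_{i,j}))=(a_{j-i+1,n-i+1})$ and the reflection is $h((a_{i,j}))=(a_{i,n-j+i})$. $\mathcal{DST}_0(n)$ is the subspace of triangles $\nabla S$ with $r(\nabla S)=h(\nabla S)=\nabla S$ and an even number of ones in $S$. A subset $G\subseteq\{(i,j):1\le i\le j\le n\}$ is a generating index set of a subspace $V$ if $V\to\{0,1\}^G$, $(a_{i,j})\mapsto(a_{i,j})_{(i,j)\in G}$, is an isomorphism. The symbol $\delta_{a,(n\bmod b)}$ is $1$ if $n\equiv a\pmod b$ and $0$ otherwise. -}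

module Defs where

open import Data.Bool using (Bool; true; false; _xor_; if_then_else_)
open import Data.Nat using (ℕ; zero; suc; _+_; _*_; _∸_; _≤_; _<?_; _/_; _%_; _≟_; NonZero)
open import Data.Nat.Divisibility using (_∣_)
open import Data.Fin using (Fin; fromℕ<)
import Data.Fin as Fin
open import Data.List using (List; length; lookup; map; upTo)
open import Data.List.Relation.Unary.All using (All)
open import Data.List.Relation.Unary.Unique.Propositional using (Unique)
open import Data.List.Membership.Propositional using (_∈_)
open import Data.Product using (_×_; _,_; proj₁; proj₂; ∃)
open import Relation.Nullary using (yes; no)
open import Relation.Binary.PropositionalEquality using (_≡_)

-- First row S = (S_1,…,S_n), stored 0-based as Fin n → Bool.
-- ext n S k is S_k (1-based) for 1 ≤ k ≤ n, and false otherwise (never used on valid indices).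
ext : (n : ℕ) → (Fin n → Bool) → ℕ → Bool
ext n S zero = false
ext n S (suc k) with k <? n
... | yes p = S (fromℕ< p)
... | no _ = false

-- Entries a_{i,j} of the Steinhaus triangle ∇S (1-based indices; meaningful for 1 ≤ i ≤ j ≤ n).
-- a_{1,j} = S_j,  a_{i,j} = a_{i-1,j-1} + a_{i-1,j} (mod 2).
nabla : {n : ℕ} → (Fin n → Bool) → ℕ → ℕ → Bool
nabla S zero j = false
nabla {n} S (suc zero) j = ext n S j
nabla S (suc (suc i)) zero = false
nabla S (suc (suc i)) (suc j) = nabla S (suc i) j xor nabla S (suc i) (suc j)

Valid : ℕ → ℕ × ℕ → Set
Valid n (i , j) = 1 ≤ i × i ≤ j × j ≤ n

RotInv : (n : ℕ) → (Fin n → Bool) → Set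
RotInv n S = ∀ i j → Valid n (i , j) → nabla S (j ∸ i + 1) (n ∸ i + 1) ≡ nabla S i j

RefInv : (n : ℕ) → (Fin n → Bool) → Set
RefInv n S = ∀ i j → Valid n (i , j) → nabla S i (n ∸ j + i) ≡ nabla S i j

countOnes : (n : ℕ) → (Fin n → Bool) → ℕ
countOnes zero S = 0
countOnes (suc n) S = (if S Fin.zero then 1 else 0) + countOnes n (λ k → S (Fin.suc k))

-- ∇S ∈ DST₀(n)  (expressed on the first row S, which determines ∇S)
InDST0 : (n : ℕ) → (Fin n → Bool) → Set
InDST0 n S = RotInv n S × RefInv n S × (2 ∣ countOnes n S)

SameTriangle : (n : ℕ) → (Fin n → Bool) → (Fin n → Bool) → Set
SameTriangle n S S' = ∀ i j → Valid n (i , j) → nabla S i j ≡ nabla S' i j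

-- G (a finite set of indices, given as a duplicate-free list of valid indices) is a
-- generating index set of the subspace V = {∇S : P S}: the restriction map
-- V → {0,1}^G is injective and surjective.
IsGeneratingIndexSet : (n : ℕ) → ((Fin n → Bool) → Set) → List (ℕ × ℕ) → Set
IsGeneratingIndexSet n P G =
  All (Valid n) G × Unique G ×
  (∀ S S' → P S → P S' →
     (∀ ij → ij ∈ G → nabla S (proj₁ ij) (proj₂ ij) ≡ nabla S' (proj₁ ij) (proj₂ ij)) →
     SameTriangle n S S') ×
  (∀ (f : Fin (length G) → Bool) → ∃ λ S → P S ×
     (∀ k → nabla S (proj₁ (lookup G k)) (proj₂ (lookup G k)) ≡ f k))

delta : (a n b : ℕ) → .{{NonZero b}} → ℕ
delta a n b with (n % b) ≟ a
... | yes _ = 1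
... | no _ = 0

mD0 : ℕ → ℕ
mD0 n = n / 6 + delta 4 n 6

GD0 : ℕ → (ℕ → ℕ) → List (ℕ × ℕ)
GD0 n j with n % 2
... | 0 = map (λ i → (2 * i + 1 , j (2 * i + 1))) (upTo (mD0 n))
... | _ = map (λ i → (2 * (i + 1) , j (2 * (i + 1)))) (upTo (mD0 n))

module Submission where

-- The proof is an induction n ↦ n - 3 on the "interior" of a triangle: deleting the
-- first row and both outer sides of a triangle in DST₀(n + 3) leaves one in DST₀(n).
-- The generators of n + 3 are the generators of n shifted one row down (columns
-- shifted by two), plus the extra generator (1, j_1) when n is odd.
--
--  * injectivity: if X ∈ DST₀(n + 3) vanishes on the generators, its interior vanishes
--    on its generators, hence is zero by induction; then the first row of X is
--    0, c, …, c, 0, and c = 0 either by the generator (1, j_1) or by the parity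
--    condition on the palindromic row of odd length;
--  * surjectivity: every U ∈ DST₀(n) is the interior of the explicit triangles of the
--    module Lift, parametrised by one bit c, which is used to meet the new generator
--    or the parity condition.

open import Defs
open import Data.Bool using (Bool; true; false; not; _xor_; if_then_else_)
open import Data.Bool.Properties
  using (xor-comm; xor-assoc; xor-same; xor-identityʳ; not-involutive; not-injective)
open import Data.Nat
  using (ℕ; zero; suc; _+_; _*_; _∸_; _/_; _%_; pred; _≤_; _<_; s≤s; z≤n; _<?_; _≤?_; _≟_)
open import Data.Nat.Properties
open import Data.Nat.DivMod using (m/n≡1+[m∸n]/n; [m+n]%n≡m%n; m*n/n≡m; /-monoˡ-≤)
open import Data.Nat.Divisibility using (_∣_; divides)
open import Data.Fin using (Fin; toℕ; fromℕ<)
import Data.Fin as Fin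
open import Data.Fin.Properties using (toℕ-fromℕ<; fromℕ<-toℕ; toℕ<n)
open import Data.Product using (Σ; ∃; _×_; _,_; proj₁; proj₂)
open import Data.Sum using (inj₁; inj₂)
open import Data.Empty using (⊥-elim)
open import Data.List using (List; length; lookup; applyUpTo)
open import Data.List.Properties using (map-upTo; lookup-applyUpTo; length-applyUpTo)
open import Data.List.Relation.Unary.All using (All)
open import Data.List.Relation.Unary.All.Properties using (applyUpTo⁺₁)
open import Data.List.Relation.Unary.Unique.Propositional using (Unique)
import Data.List.Relation.Unary.Unique.Propositional.Properties as Unique
open import Data.List.Membership.Propositional using (_∈_)
open import Data.List.Membership.Propositional.Properties using (∈-applyUpTo⁺)
open import Relation.Nullary using (yes; no)
open import Relation.Binary.PropositionalEquality

xor-cancelʳ : ∀ x y → (x xor y) xor y ≡ x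
xor-cancelʳ false false = refl
xor-cancelʳ false true  = refl
xor-cancelʳ true  false = refl
xor-cancelʳ true  true  = refl

xor-cancelˡ : ∀ x y → x xor (x xor y) ≡ y
xor-cancelˡ false y     = refl
xor-cancelˡ true  false = refl
xor-cancelˡ true  true  = refl

xor-solve : ∀ {x y z} → x ≡ y xor z → y ≡ x xor z
xor-solve {y = y} {z} refl = sym (xor-cancelʳ y z)

xor-equal : ∀ {x y} → x xor y ≡ false → x ≡ y
xor-equal {x} {y} e = trans (sym (xor-cancelʳ x y)) (cong (_xor y) e)

xor-interchange : ∀ a b c d → (a xor b) xor (c xor d) ≡ (a xor c) xor (b xor d)
xor-interchange a b c d = begin
  (a xor b) xor (c xor d)   ≡⟨ xor-assoc a b (c xor d) ⟩
  a xor (b xor (c xor d))   ≡⟨ cong (a xor_) (sym (xor-assoc b c d)) ⟩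
  a xor ((b xor c) xor d)   ≡⟨ cong (λ x → a xor (x xor d)) (xor-comm b c) ⟩
  a xor ((c xor b) xor d)   ≡⟨ cong (a xor_) (xor-assoc c b d) ⟩
  a xor (c xor (b xor d))   ≡⟨ sym (xor-assoc a c (b xor d)) ⟩
  (a xor c) xor (b xor d)   ∎
  where open ≡-Reasoning

row : (n : ℕ) → (ℕ → Bool) → Fin n → Bool
row n r k = r (suc (toℕ k))

ext-row : ∀ n r k → 1 ≤ k → k ≤ n → ext n (row n r) k ≡ r k
ext-row n r (suc k) _ k<n with k <? n
... | yes p  = cong (λ x → r (suc x)) (toℕ-fromℕ< p)
... | no k≮n = ⊥-elim (k≮n k<n)

zeroRow : (n : ℕ) → Fin n → Bool
zeroRow n _ = false

ext-zeroRow : ∀ n k → ext n (zeroRow n) k ≡ false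
ext-zeroRow n zero = refl
ext-zeroRow n (suc k) with k <? n
... | yes _ = refl
... | no _  = refl

nabla-zeroRow : ∀ n i j → nabla (zeroRow n) i j ≡ false
nabla-zeroRow n zero j                = refl
nabla-zeroRow n (suc zero) j          = ext-zeroRow n j
nabla-zeroRow n (suc (suc i)) zero    = refl
nabla-zeroRow n (suc (suc i)) (suc j) =
  cong₂ _xor_ (nabla-zeroRow n (suc i) j) (nabla-zeroRow n (suc i) (suc j))

_⊕_ : ∀ {n} → (Fin n → Bool) → (Fin n → Bool) → Fin n → Bool
(S ⊕ S') k = S k xor S' k

ext-⊕ : ∀ n S S' k → ext n (S ⊕ S') k ≡ ext n S k xor ext n S' k
ext-⊕ n S S' zero = refl
ext-⊕ n S S' (suc k) with k <? n
... | yes _ = refl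
... | no _  = refl

nabla-⊕ : ∀ n S S' i j → nabla {n} (S ⊕ S') i j ≡ nabla S i j xor nabla S' i j
nabla-⊕ n S S' zero j                = refl
nabla-⊕ n S S' (suc zero) j          = ext-⊕ n S S' j
nabla-⊕ n S S' (suc (suc i)) zero    = refl
nabla-⊕ n S S' (suc (suc i)) (suc j) =
  trans (cong₂ _xor_ (nabla-⊕ n S S' (suc i) j) (nabla-⊕ n S S' (suc i) (suc j)))
        (xor-interchange (nabla S (suc i) j) (nabla S' (suc i) j)
                         (nabla S (suc i) (suc j)) (nabla S' (suc i) (suc j)))

SteinhausRule : (ℕ → ℕ → Bool) → Set
SteinhausRule a = ∀ i j → 1 ≤ i → a (suc i) (suc j) ≡ a i j xor a i (suc j)

nabla-rule : ∀ {n} (S : Fin n → Bool) → SteinhausRule (nabla S)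
nabla-rule S (suc i) j _ = refl

rule-unique : ∀ n a b → SteinhausRule a → SteinhausRule b →
              (∀ j → 1 ≤ j → j ≤ n → a 1 j ≡ b 1 j) →
              ∀ i j → 1 ≤ i → i ≤ j → j ≤ n → a i j ≡ b i j
rule-unique n a b ra rb r1 (suc zero) j _ ij jn = r1 j ij jn
rule-unique n a b ra rb r1 (suc (suc i)) (suc j) _ (s≤s ij) jn =
  trans (ra (suc i) j (s≤s z≤n))
    (trans (cong₂ _xor_ (rule-unique n a b ra rb r1 (suc i) j (s≤s z≤n) ij (≤-trans (n≤1+n j) jn))
                        (rule-unique n a b ra rb r1 (suc i) (suc j) (s≤s z≤n) (m≤n⇒m≤1+n ij) jn))
           (sym (rb (suc i) j (s≤s z≤n))))

-- The two symmetries, with their index arithmetic written additively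

RotSym : ℕ → (ℕ → ℕ → Bool) → Set
RotSym n a = ∀ i j p q → 1 ≤ i → i ≤ j → j ≤ n →
             p + i ≡ suc j → q + i ≡ suc n → a p q ≡ a i j

RefSym : ℕ → (ℕ → ℕ → Bool) → Set
RefSym n a = ∀ i j k → 1 ≤ i → i ≤ j → j ≤ n → k + j ≡ n + i → a i k ≡ a i j

Palindrome : ℕ → (ℕ → Bool) → Set
Palindrome n r = ∀ a b → a + b ≡ suc n → 1 ≤ a → 1 ≤ b → r a ≡ r b

+1≡suc : ∀ p → p + 1 ≡ suc p
+1≡suc p = +-comm p 1

summand≤ : ∀ q {i n} → 1 ≤ i → q + i ≡ suc n → q ≤ n
summand≤ q {suc i} _ e = subst (q ≤_) (suc-injective (trans (sym (+-suc q i)) e)) (m≤m+n q i)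

rot-valid : ∀ {n i j p q} → 1 ≤ i → i ≤ j → j ≤ n → p + i ≡ suc j → q + i ≡ suc n →
            1 ≤ p × p ≤ q × q ≤ n
rot-valid {n} {suc i} {j} {p} {q} _ ij jn e1 e2 =
  positive p ij e1 ,
  +-cancelʳ-≤ (suc i) p q (subst₂ _≤_ (sym e1) (sym e2) (s≤s jn)) ,
  summand≤ q (s≤s z≤n) e2
  where
  positive : ∀ p {i j} → i ≤ j → p + i ≡ suc j → 1 ≤ p
  positive zero    ij e = ⊥-elim (1+n≰n (subst (_≤ _) e ij))
  positive (suc _) ij e = s≤s z≤n

ref-valid : ∀ {n i j k} → i ≤ j → j ≤ n → k + j ≡ n + i → i ≤ k × k ≤ n
ref-valid {n} {i} {j} {k} ij jn e =
  +-cancelʳ-≤ j i k (subst (i + j ≤_) (sym e) (subst (_≤ n + i) (+-comm j i) (+-monoˡ-≤ i jn))) ,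
  +-cancelʳ-≤ j k n (subst (_≤ n + j) (sym e) (+-monoʳ-≤ n ij))

-- A palindromic first row makes the whole triangle reflection invariant:
-- the rule propagates the mirror symmetry from row i to row i + 1.
refSym-from-palindrome : ∀ n a → SteinhausRule a → Palindrome n (a 1) → RefSym n a
refSym-from-palindrome n a ra pal (suc zero) j k _ ij jn e =
  pal k j (trans e (+-comm n 1)) (positive k e) ij
  where
  positive : ∀ k → k + j ≡ n + 1 → 1 ≤ k
  positive zero    e = ⊥-elim (1+n≰n (subst (_≤ n) (trans e (+-comm n 1)) jn))
  positive (suc _) e = s≤s z≤n
refSym-from-palindrome n a ra pal (suc (suc i)) (suc j) zero _ (s≤s ij) jn e =
  ⊥-elim (m+1+n≰m n (subst (_≤ n) e jn))
refSym-from-palindrome n a ra pal (suc (suc i)) (suc j) (suc k) _ (s≤s ij) jn e =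
  begin
    a (suc (suc i)) (suc k)           ≡⟨ ra (suc i) k (s≤s z≤n) ⟩
    a (suc i) k xor a (suc i) (suc k) ≡⟨ cong₂ _xor_ mirror₁ mirror₂ ⟩
    a (suc i) (suc j) xor a (suc i) j ≡⟨ xor-comm (a (suc i) (suc j)) (a (suc i) j) ⟩
    a (suc i) j xor a (suc i) (suc j) ≡⟨ sym (ra (suc i) j (s≤s z≤n)) ⟩
    a (suc (suc i)) (suc j)           ∎
  where
  open ≡-Reasoning
  e₁ : k + suc j ≡ n + suc i
  e₁ = suc-injective (trans e (+-suc n (suc i)))
  mirror₁ : a (suc i) k ≡ a (suc i) (suc j)
  mirror₁ = refSym-from-palindrome n a ra pal (suc i) (suc j) k (s≤s z≤n) (m≤n⇒m≤1+n ij) jn e₁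
  mirror₂ : a (suc i) (suc k) ≡ a (suc i) j
  mirror₂ = refSym-from-palindrome n a ra pal (suc i) j (suc k) (s≤s z≤n) ij
              (≤-trans (n≤1+n j) jn) (trans (sym (+-suc k j)) e₁)

-- If the last column a_{k,n} equals the first row a_{1,k}, the whole triangle
-- is rotation invariant: the rule propagates the symmetry along the rows.
rotSym-from-edge : ∀ n a → SteinhausRule a →
                   (∀ k → 1 ≤ k → k ≤ n → a k n ≡ a 1 k) → RotSym n a
rotSym-from-edge n a ra edge (suc zero) j p q _ ij jn e1 e2 =
  subst₂ (λ x y → a x y ≡ a 1 j)
    (sym (suc-injective (trans (sym (+1≡suc p)) e1)))
    (sym (suc-injective (trans (sym (+1≡suc q)) e2)))
    (edge j ij jn)
rotSym-from-edge n a ra edge (suc (suc i)) (suc j) zero q _ (s≤s ij) jn e1 e2 =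
  ⊥-elim (1+n≰n (subst (_≤ j) (suc-injective e1) ij))
rotSym-from-edge n a ra edge (suc (suc i)) (suc j) (suc p) q _ (s≤s ij) jn e1 e2 =
  let e₁ : suc p + suc i ≡ suc j
      e₁ = suc-injective (trans (sym (+-suc (suc p) (suc i))) e1)
      e₂ : suc q + suc i ≡ suc n
      e₂ = trans (sym (+-suc q (suc i))) e2
      image₁ : a (suc p) (suc q) ≡ a (suc i) j
      image₁ = rotSym-from-edge n a ra edge (suc i) j (suc p) (suc q) (s≤s z≤n) ij
                 (≤-trans (n≤1+n j) jn) e₁ e₂
      image₂ : a (suc (suc p)) (suc q) ≡ a (suc i) (suc j)
      image₂ = rotSym-from-edge n a ra edge (suc i) (suc j) (suc (suc p)) (suc q) (s≤s z≤n)
                 (m≤n⇒m≤1+n ij) jn (cong suc e₁) e₂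
  in begin
    a (suc p) q                                   ≡⟨ xor-solve (ra (suc p) q (s≤s z≤n)) ⟩
    a (suc (suc p)) (suc q) xor a (suc p) (suc q) ≡⟨ cong₂ _xor_ image₂ image₁ ⟩
    a (suc i) (suc j) xor a (suc i) j             ≡⟨ xor-comm (a (suc i) (suc j)) (a (suc i) j) ⟩
    a (suc i) j xor a (suc i) (suc j)             ≡⟨ sym (ra (suc i) j (s≤s z≤n)) ⟩
    a (suc (suc i)) (suc j)                       ∎
  where open ≡-Reasoning

rot-index : ∀ {i j} → i ≤ j → (j ∸ i + 1) + i ≡ suc j
rot-index {i} {j} ij = begin
  (j ∸ i + 1) + i   ≡⟨ cong (_+ i) (+1≡suc (j ∸ i)) ⟩
  suc (j ∸ i + i)   ≡⟨ cong suc (m∸n+n≡m ij) ⟩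
  suc j             ∎
  where open ≡-Reasoning

ref-index : ∀ {n i j} → j ≤ n → (n ∸ j + i) + j ≡ n + i
ref-index {n} {i} {j} jn = begin
  (n ∸ j + i) + j   ≡⟨ +-assoc (n ∸ j) i j ⟩
  n ∸ j + (i + j)   ≡⟨ cong (n ∸ j +_) (+-comm i j) ⟩
  n ∸ j + (j + i)   ≡⟨ sym (+-assoc (n ∸ j) j i) ⟩
  (n ∸ j + j) + i   ≡⟨ cong (_+ i) (m∸n+n≡m jn) ⟩
  n + i             ∎
  where open ≡-Reasoning

rotInv⇒rotSym : ∀ n S → RotInv n S → RotSym n (nabla S)
rotInv⇒rotSym n S h i j p q i1 ij jn e1 e2 =
  subst₂ (λ x y → nabla S x y ≡ nabla S i j)
    (+-cancelʳ-≡ i _ p (trans (rot-index ij) (sym e1)))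
    (+-cancelʳ-≡ i _ q (trans (rot-index (≤-trans ij jn)) (sym e2)))
    (h i j (i1 , ij , jn))

rotSym⇒rotInv : ∀ n S → RotSym n (nabla S) → RotInv n S
rotSym⇒rotInv n S h i j (i1 , ij , jn) =
  h i j _ _ i1 ij jn (rot-index ij) (rot-index (≤-trans ij jn))

refInv⇒refSym : ∀ n S → RefInv n S → RefSym n (nabla S)
refInv⇒refSym n S h i j k i1 ij jn e =
  subst (λ x → nabla S i x ≡ nabla S i j) (+-cancelʳ-≡ j _ k (trans (ref-index jn) (sym e)))
        (h i j (i1 , ij , jn))

refSym⇒refInv : ∀ n S → RefSym n (nabla S) → RefInv n S
refSym⇒refInv n S h i j (i1 , ij , jn) = h i j _ i1 ij jn (ref-index jn)

refSym⇒palindrome : ∀ n a → RefSym n a → Palindrome n (a 1)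
refSym⇒palindrome n a h x y e x1 y1 =
  h 1 y x (s≤s z≤n) y1 (summand≤ y x1 (trans (+-comm y x) e)) (trans e (+-comm 1 n))

rowSum : (ℕ → Bool) → ℕ → Bool
rowSum r zero    = false
rowSum r (suc k) = rowSum r k xor r (suc k)

rowSum-cong : ∀ r r' k → (∀ t → 1 ≤ t → t ≤ k → r t ≡ r' t) → rowSum r k ≡ rowSum r' k
rowSum-cong r r' zero    h = refl
rowSum-cong r r' (suc k) h =
  cong₂ _xor_ (rowSum-cong r r' k (λ t t1 tk → h t t1 (m≤n⇒m≤1+n tk)))
              (h (suc k) (s≤s z≤n) ≤-refl)

rowSum-xor : ∀ r r' k → rowSum (λ t → r t xor r' t) k ≡ rowSum r k xor rowSum r' k
rowSum-xor r r' zero    = refl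
rowSum-xor r r' (suc k) =
  trans (cong (_xor (r (suc k) xor r' (suc k))) (rowSum-xor r r' k))
        (xor-interchange (rowSum r k) (rowSum r' k) (r (suc k)) (r' (suc k)))

rowSum-front : ∀ r k → rowSum r (suc k) ≡ r 1 xor rowSum (λ t → r (suc t)) k
rowSum-front r zero    = xor-comm false (r 1)
rowSum-front r (suc k) =
  trans (cong (_xor r (suc (suc k))) (rowSum-front r k))
        (xor-assoc (r 1) (rowSum (λ t → r (suc t)) k) (r (suc (suc k))))

rowSum-telescope : ∀ (r : ℕ → Bool) N → rowSum (λ k → r k xor r (suc k)) N ≡ r 1 xor r (suc N)
rowSum-telescope r zero    = sym (xor-same (r 1))
rowSum-telescope r (suc N) = begin
  rowSum (λ k → r k xor r (suc k)) N xor (r (suc N) xor r (suc (suc N)))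
    ≡⟨ cong (_xor (r (suc N) xor r (suc (suc N)))) (rowSum-telescope r N) ⟩
  (r 1 xor r (suc N)) xor (r (suc N) xor r (suc (suc N)))
    ≡⟨ xor-assoc (r 1) (r (suc N)) _ ⟩
  r 1 xor (r (suc N) xor (r (suc N) xor r (suc (suc N))))
    ≡⟨ cong (r 1 xor_) (xor-cancelˡ (r (suc N)) (r (suc (suc N)))) ⟩
  r 1 xor r (suc (suc N)) ∎
  where open ≡-Reasoning

-- For a palindrome of length N, the sums of the first a and first b entries
-- add up to the total sum whenever a + b = N (the last b entries mirror the first b).
rowSum-palindrome-split : ∀ r N → Palindrome N r →
                          ∀ a b → a + b ≡ N → rowSum r a xor rowSum r b ≡ rowSum r N
rowSum-palindrome-split r N pal zero b refl = refl
rowSum-palindrome-split r N pal (suc a) b e = begin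
  (rowSum r a xor r (suc a)) xor rowSum r b   ≡⟨ xor-assoc (rowSum r a) (r (suc a)) (rowSum r b) ⟩
  rowSum r a xor (r (suc a) xor rowSum r b)
    ≡⟨ cong (rowSum r a xor_) (xor-comm (r (suc a)) (rowSum r b)) ⟩
  rowSum r a xor (rowSum r b xor r (suc a))
    ≡⟨ cong (λ x → rowSum r a xor (rowSum r b xor x)) mirror ⟩
  rowSum r a xor rowSum r (suc b)
    ≡⟨ rowSum-palindrome-split r N pal a (suc b) (trans (+-suc a b) e) ⟩
  rowSum r N                                  ∎
  where
  open ≡-Reasoning
  mirror : r (suc a) ≡ r (suc b)
  mirror = pal (suc a) (suc b) (trans (+-suc (suc a) b) (cong suc e)) (s≤s z≤n) (s≤s z≤n)

rowSum-palindrome-odd : ∀ r N M → Palindrome N r → N ≡ suc (M + M) → rowSum r N ≡ r (suc M)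
rowSum-palindrome-odd r N M pal e =
  trans (sym (rowSum-palindrome-split r N pal M (suc M) (trans (+-suc M M) (sym e))))
        (xor-cancelˡ (rowSum r M) (r (suc M)))

rowSum-palindrome-even : ∀ r N M → Palindrome N r → N ≡ M + M → rowSum r N ≡ false
rowSum-palindrome-even r N M pal e =
  trans (sym (rowSum-palindrome-split r N pal M M (sym e))) (xor-same (rowSum r M))

bit-cases : ∀ {A : Set} b → (b ≡ true → A) → (b ≡ false → A) → A
bit-cases true  t f = t refl
bit-cases false t f = f refl

isOdd : ℕ → Bool
isOdd zero    = false
isOdd (suc n) = not (isOdd n)

isOdd-3+ : ∀ N → isOdd (3 + N) ≡ not (isOdd N)
isOdd-3+ N = cong not (not-involutive (isOdd N))

mutual
  even-half : ∀ n → isOdd n ≡ false → Σ ℕ (λ M → n ≡ M + M)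
  even-half zero    _ = 0 , refl
  even-half (suc n) e with odd-half n (not-injective e)
  ... | M , eq = suc M , cong suc (trans eq (sym (+-suc M M)))

  odd-half : ∀ n → isOdd n ≡ true → Σ ℕ (λ M → n ≡ suc (M + M))
  odd-half (suc n) e with even-half n (not-injective e)
  ... | M , eq = M , cong suc eq

even⇒2∣ : ∀ c → isOdd c ≡ false → 2 ∣ c
even⇒2∣ c e with even-half c e
... | M , eq = divides M (trans eq (trans (cong (M +_) (sym (+-identityʳ M))) (*-comm 2 M)))

2∣⇒even : ∀ c → 2 ∣ c → isOdd c ≡ false
2∣⇒even .(q * 2) (divides q refl) = doubled q
  where
  doubled : ∀ q → isOdd (q * 2) ≡ false
  doubled zero    = refl
  doubled (suc q) = trans (not-involutive (isOdd (q * 2))) (doubled q)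

ext-suc : ∀ n S k → ext (suc n) S (suc (suc k)) ≡ ext n (λ x → S (Fin.suc x)) (suc k)
ext-suc n S k with suc k <? suc n | k <? n
... | yes p | yes q = refl
... | yes p | no q  = ⊥-elim (q (≤-pred p))
... | no p  | yes q = ⊥-elim (p (s≤s q))
... | no p  | no q  = refl

ext-one : ∀ n S → ext (suc n) S 1 ≡ S Fin.zero
ext-one n S with 0 <? suc n
... | yes p = refl
... | no p  = ⊥-elim (p (s≤s z≤n))

isOdd-countOnes : ∀ n S → isOdd (countOnes n S) ≡ rowSum (ext n S) n
isOdd-countOnes zero    S = refl
isOdd-countOnes (suc n) S = begin
  isOdd (countOnes (suc n) S)
    ≡⟨ isOdd-step (S Fin.zero) (countOnes n tail) ⟩
  S Fin.zero xor isOdd (countOnes n tail)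
    ≡⟨ cong₂ _xor_ (sym (ext-one n S)) (isOdd-countOnes n tail) ⟩
  ext (suc n) S 1 xor rowSum (ext n tail) n
    ≡⟨ cong (ext (suc n) S 1 xor_) (rowSum-cong _ _ n (λ { (suc t) _ _ → sym (ext-suc n S t) })) ⟩
  ext (suc n) S 1 xor rowSum (λ t → ext (suc n) S (suc t)) n
    ≡⟨ sym (rowSum-front (ext (suc n) S) n) ⟩
  rowSum (ext (suc n) S) (suc n) ∎
  where
  open ≡-Reasoning
  tail : Fin n → Bool
  tail k = S (Fin.suc k)
  isOdd-step : ∀ b c → isOdd ((if b then 1 else 0) + c) ≡ b xor isOdd c
  isOdd-step true  c = refl
  isOdd-step false c = refl

DST : (n : ℕ) → (Fin n → Bool) → Set
DST n S = RotSym n (nabla S) × RefSym n (nabla S) × rowSum (ext n S) n ≡ false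

InDST0⇒DST : ∀ n S → InDST0 n S → DST n S
InDST0⇒DST n S (rot , ref , even) =
  rotInv⇒rotSym n S rot , refInv⇒refSym n S ref ,
  trans (sym (isOdd-countOnes n S)) (2∣⇒even _ even)

DST⇒InDST0 : ∀ n S → DST n S → InDST0 n S
DST⇒InDST0 n S (rot , ref , even) =
  rotSym⇒rotInv n S rot , refSym⇒refInv n S ref ,
  even⇒2∣ _ (trans (isOdd-countOnes n S) even)

DST-zero : ∀ n → DST n (zeroRow n)
DST-zero n =
  (λ i j p q _ _ _ _ _ → trans (nabla-zeroRow n p q) (sym (nabla-zeroRow n i j))) ,
  (λ i j k _ _ _ _ → trans (nabla-zeroRow n i k) (sym (nabla-zeroRow n i j))) ,
  trans (rowSum-cong _ _ n (λ t _ _ → ext-zeroRow n t)) (rowSum-zero n)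
  where
  rowSum-zero : ∀ k → rowSum (λ _ → false) k ≡ false
  rowSum-zero zero    = refl
  rowSum-zero (suc k) = cong (_xor false) (rowSum-zero k)

DST-⊕ : ∀ n S S' → DST n S → DST n S' → DST n (S ⊕ S')
DST-⊕ n S S' (rot , ref , even) (rot' , ref' , even') =
  (λ i j p q i1 ij jn e1 e2 →
     sum-invariant p q i j (rot i j p q i1 ij jn e1 e2) (rot' i j p q i1 ij jn e1 e2)) ,
  (λ i j k i1 ij jn e → sum-invariant i k i j (ref i j k i1 ij jn e) (ref' i j k i1 ij jn e)) ,
  trans (rowSum-cong _ _ n (λ t _ _ → ext-⊕ n S S' t))
        (trans (rowSum-xor (ext n S) (ext n S') n) (cong₂ _xor_ even even'))
  where
  sum-invariant : ∀ p q i j → nabla S p q ≡ nabla S i j → nabla S' p q ≡ nabla S' i j →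
                  nabla (S ⊕ S') p q ≡ nabla (S ⊕ S') i j
  sum-invariant p q i j e e' =
    trans (nabla-⊕ n S S' p q) (trans (cong₂ _xor_ e e') (sym (nabla-⊕ n S S' i j)))

-- The interior triangle

-- The interior of ∇S for S of length N + 3 is the triangle of size N obtained by
-- deleting the first row and both outer sides; its first row is a_{2,3}, …, a_{2,N+2}.
interior : (N : ℕ) → (Fin (3 + N) → Bool) → Fin N → Bool
interior N S = row N (λ k → nabla S 2 (2 + k))

HasInterior : (N : ℕ) → (Fin (3 + N) → Bool) → (Fin N → Bool) → Set
HasInterior N S U = ∀ i j → 1 ≤ i → i ≤ j → j ≤ N → nabla S (suc i) (2 + j) ≡ nabla U i j

-- By uniqueness, it suffices to compare first rows.
hasInterior : ∀ N S U → (∀ t → 1 ≤ t → t ≤ N → nabla S 2 (2 + t) ≡ ext N U t) →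
              HasInterior N S U
hasInterior N S U row₂ =
  rule-unique N (λ i j → nabla S (suc i) (2 + j)) (nabla U) (λ i j _ → refl) (nabla-rule U) row₂

interior-spec : ∀ N S → HasInterior N S (interior N S)
interior-spec N S =
  hasInterior N S (interior N S) (λ t t1 tN → sym (ext-row N (λ k → nabla S 2 (2 + k)) t t1 tN))

-- The interior of a triangle in DST(N + 3) lies in DST(N): both symmetries restrict,
-- and the interior's first row telescopes to a_{1,2} ⊕ a_{1,N+2} = 0.
interior-DST : ∀ N S U → HasInterior N S U → DST (3 + N) S → DST N U
interior-DST N S U inner (rot , ref , _) = rotU , refU , evenU
  where
  rotU : RotSym N (nabla U)
  rotU i j p q i1 ij jN e1 e2 with rot-valid i1 ij jN e1 e2
  ... | p1 , pq , qN =
    trans (sym (inner p q p1 pq qN))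
      (trans (rot (suc i) (2 + j) (suc p) (2 + q) (s≤s z≤n) (s≤s (m≤n⇒m≤1+n ij))
                  (s≤s (s≤s (m≤n⇒m≤1+n jN)))
                  (trans (+-suc (suc p) i) (cong (λ x → suc (suc x)) e1))
                  (cong (λ x → suc (suc x)) (trans (+-suc q i) (cong suc e2))))
             (inner i j i1 ij jN))
  refU : RefSym N (nabla U)
  refU i j k i1 ij jN e with ref-valid ij jN e
  ... | ik , kN =
    trans (sym (inner i k i1 ik kN))
      (trans (ref (suc i) (2 + j) (2 + k) (s≤s z≤n) (s≤s (m≤n⇒m≤1+n ij))
                  (s≤s (s≤s (m≤n⇒m≤1+n jN))) mirror)
             (inner i j i1 ij jN))
    where
    mirror : (2 + k) + (2 + j) ≡ (3 + N) + suc i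
    mirror = cong (λ x → suc (suc x))
      (trans (+-suc k (suc j)) (cong suc (trans (+-suc k j) (trans (cong suc e) (sym (+-suc N i))))))
  e : ℕ → Bool
  e = ext (3 + N) S
  evenU : rowSum (ext N U) N ≡ false
  evenU = begin
    rowSum (ext N U) N
      ≡⟨ rowSum-cong _ _ N (λ t t1 tN → sym (inner 1 t (s≤s z≤n) t1 tN)) ⟩
    rowSum (λ k → e (suc k) xor e (2 + k)) N
      ≡⟨ rowSum-telescope (λ k → e (suc k)) N ⟩
    e 2 xor e (2 + N)
      ≡⟨ cong (e 2 xor_) ends ⟩
    e 2 xor e 2
      ≡⟨ xor-same (e 2) ⟩
    false ∎
    where
    open ≡-Reasoning
    ends : e (2 + N) ≡ e 2
    ends = refSym⇒palindrome (3 + N) (nabla S) ref (2 + N) 2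
             (cong (λ x → suc (suc x)) (+-comm N 2)) (s≤s z≤n) (s≤s z≤n)

-- The generating index set, peeled three rows at a time

genRow : ℕ → ℕ → ℕ
genRow n k = if isOdd n then 2 * (k + 1) else 2 * k + 1

-- Number of generators: passing from N to N + 3 adds one generator (in row 1)
-- exactly when N is odd.  This equals ⌊n/6⌋ + δ_{4,(n mod 6)}, see genCount≡mD0.
genCount : ℕ → ℕ
genCount zero                   = 0
genCount (suc zero)             = 0
genCount (suc (suc zero))       = 0
genCount (suc (suc (suc N)))    = if isOdd N then suc (genCount N) else genCount N

genRow-odd-zero : ∀ N → isOdd N ≡ true → genRow (3 + N) 0 ≡ 1
genRow-odd-zero N e rewrite e = refl

genRow-odd-suc : ∀ N k → isOdd N ≡ true → genRow (3 + N) (suc k) ≡ suc (genRow N k)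
genRow-odd-suc N k e rewrite e =
  trans (+1≡suc (2 * suc k)) (cong (λ x → suc (2 * x)) (sym (+1≡suc k)))

genRow-even : ∀ N k → isOdd N ≡ false → genRow (3 + N) k ≡ suc (genRow N k)
genRow-even N k e rewrite e = trans (*-distribˡ-+ 2 k 1) (+-suc (2 * k) 1)

genCount-odd : ∀ N → isOdd N ≡ true → genCount (3 + N) ≡ suc (genCount N)
genCount-odd N e rewrite e = refl

genCount-even : ∀ N → isOdd N ≡ false → genCount (3 + N) ≡ genCount N
genCount-even N e rewrite e = refl

genRow-positive : ∀ n k → 1 ≤ genRow n k
genRow-positive n k with isOdd n
... | true  = ≤-trans (m≤n+m 1 k) (m≤m+n (k + 1) _)
... | false = m≤n+m 1 (2 * k)

generator-lift : ∀ N k → k < genCount N →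
                 Σ ℕ (λ k' → k' < genCount (3 + N) × genRow (3 + N) k' ≡ suc (genRow N k))
generator-lift N k lt = bit-cases (isOdd N)
  (λ e → suc k , subst (suc k <_) (sym (genCount-odd N e)) (s≤s lt) , genRow-odd-suc N k e)
  (λ e → k , subst (k <_) (sym (genCount-even N e)) lt , genRow-even N k e)

Admissible : ℕ → (ℕ → ℕ) → Set
Admissible n j = ∀ k → k < genCount n →
  2 * genRow n k ≤ j (genRow n k) × j (genRow n k) + genRow n k ≤ n

-- The column choice seen from the interior: row i of the interior is row i + 1 of
-- the triangle, and its columns are shifted by two.
shrinkChoice : (ℕ → ℕ) → ℕ → ℕ
shrinkChoice j x = pred (pred (j (suc x)))

admissible-shift : ∀ N j → Admissible (3 + N) j → ∀ k → k < genCount N →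
                   j (suc (genRow N k)) ≡ 2 + shrinkChoice j (genRow N k) ×
                   2 * genRow N k ≤ shrinkChoice j (genRow N k) ×
                   shrinkChoice j (genRow N k) + genRow N k ≤ N
admissible-shift N j adm k lt with generator-lift N k lt
... | k' , lt' , shifted with adm k' lt'
... | lower , upper rewrite shifted = shift (j (suc (genRow N k))) (genRow N k) lower upper
  where
  shift : ∀ J x → 2 * suc x ≤ J → J + suc x ≤ 3 + N →
          J ≡ 2 + pred (pred J) × 2 * x ≤ pred (pred J) × pred (pred J) + x ≤ N
  shift (suc (suc J)) x lower upper =
    refl ,
    ≤-pred (≤-pred (subst (_≤ 2 + J) (*-suc 2 x) lower)) ,
    ≤-pred (≤-pred (≤-pred (subst (_≤ 3 + N) (cong (λ y → suc (suc y)) (+-suc J x)) upper)))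
  shift (suc zero) x lower upper =
    ⊥-elim (1+n≰n (≤-trans (s≤s (s≤s z≤n)) (subst (_≤ 1) (*-suc 2 x) lower)))
  shift zero x lower upper = ⊥-elim (1+n≰n (≤-trans (s≤s z≤n) (subst (_≤ 0) (*-suc 2 x) lower)))

admissible-interior : ∀ N j → Admissible (3 + N) j → Admissible N (shrinkChoice j)
admissible-interior N j adm k lt = proj₂ (admissible-shift N j adm k lt)

TakesValues : (n : ℕ) → (ℕ → ℕ) → (Fin n → Bool) → (ℕ → Bool) → Set
TakesValues n j X f = ∀ k → k < genCount n → nabla X (genRow n k) (j (genRow n k)) ≡ f k

generator-shift : ∀ N j → Admissible (3 + N) j → ∀ S U → HasInterior N S U →
                  ∀ k k' → k < genCount N → genRow (3 + N) k' ≡ suc (genRow N k) →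
                  nabla S (genRow (3 + N) k') (j (genRow (3 + N) k'))
                    ≡ nabla U (genRow N k) (shrinkChoice j (genRow N k))
generator-shift N j adm S U inner k k' lt shifted with admissible-shift N j adm k lt
... | column , lower , upper =
  trans (cong (λ r → nabla S r (j r)) shifted)
    (trans (cong (nabla S (suc (genRow N k))) column)
      (inner (genRow N k) (shrinkChoice j (genRow N k)) (genRow-positive N k)
             (≤-trans (m≤m+n (genRow N k) _) lower) (m+n≤o⇒m≤o _ upper)))

first-generator : ∀ N j → Admissible (3 + N) j → isOdd N ≡ true →
                  0 < genCount (3 + N) × genRow (3 + N) 0 ≡ 1 × 2 ≤ j 1 × j 1 ≤ 2 + N
first-generator N j adm e =
  present , genRow-odd-zero N e , proj₁ bounds ,
  ≤-pred (subst (_≤ 3 + N) (+1≡suc (j 1)) (proj₂ bounds))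
  where
  present : 0 < genCount (3 + N)
  present = subst (0 <_) (sym (genCount-odd N e)) (s≤s z≤n)
  bounds : 2 * 1 ≤ j 1 × j 1 + 1 ≤ 3 + N
  bounds = subst (λ r → 2 * r ≤ j r × j r + r ≤ 3 + N) (genRow-odd-zero N e) (adm 0 present)

middle-position : ∀ N → isOdd N ≡ false → Σ ℕ (λ M → 3 + N ≡ suc (suc M + suc M) × M ≤ N)
middle-position N e with odd-half (3 + N) (trans (isOdd-3+ N) (cong not e))
... | zero  , ()
... | suc M , eM = M , eM , subst (M ≤_) (sym N≡M+M) (m≤m+n M M)
  where
  N≡M+M : N ≡ M + M
  N≡M+M = suc-injective (trans (suc-injective (suc-injective eM)) (+-suc M M))

-- Injectivity: a triangle of DST(n) vanishing on the generators is zero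

RowZero : (n : ℕ) → (Fin n → Bool) → Set
RowZero n X = ∀ t → 1 ≤ t → t ≤ n → ext n X t ≡ false

Framed : (N : ℕ) → (Fin (3 + N) → Bool) → Set
Framed N X = ext (3 + N) X 1 ≡ false ×
             (∀ t → 2 ≤ t → t ≤ 2 + N → ext (3 + N) X t ≡ ext (3 + N) X 2) ×
             ext (3 + N) X (3 + N) ≡ false

framed-zero : ∀ N X → Framed N X → ext (3 + N) X 2 ≡ false → RowZero (3 + N) X
framed-zero N X (first , constant , last) c≡0 (suc zero) _ _ = first
framed-zero N X (first , constant , last) c≡0 (suc (suc t)) _ le with m≤n⇒m<n∨m≡n le
... | inj₁ lt   = trans (constant (2 + t) (s≤s (s≤s z≤n)) (≤-pred lt)) c≡0
... | inj₂ refl = last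

-- If X ∈ DST(N + 3) has zero interior, its first row is framed: a zero second row
-- forces equal neighbours, and the symmetries force the ends to vanish.
frame-row : ∀ N X → DST (3 + N) X → RowZero N (interior N X) → Framed N X
frame-row N X (rot , ref , _) zero-interior = first , constant , last
  where
  e : ℕ → Bool
  e = ext (3 + N) X
  neighbours : ∀ t → 1 ≤ t → t ≤ N → e (suc t) ≡ e (2 + t)
  neighbours t t1 tN =
    xor-equal (trans (sym (ext-row N (λ k → nabla X 2 (2 + k)) t t1 tN)) (zero-interior t t1 tN))
  constant-from-2 : ∀ t → t ≤ N → e (2 + t) ≡ e 2
  constant-from-2 zero    _  = refl
  constant-from-2 (suc t) le =
    trans (sym (neighbours (suc t) (s≤s z≤n) le)) (constant-from-2 t (≤-trans (n≤1+n t) le))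
  constant : ∀ t → 2 ≤ t → t ≤ 2 + N → e t ≡ e 2
  constant (suc (suc t)) _ le = constant-from-2 t (≤-pred (≤-pred le))
  constant (suc zero) (s≤s ()) _
  -- rotation maps (1, N + 2) to (2, 2):  a_{1,N+2} = a_{1,1} ⊕ a_{1,2}
  first : e 1 ≡ false
  first = trans (xor-solve (trans (sym (constant-from-2 N ≤-refl))
                   (rot 2 2 1 (2 + N) (s≤s z≤n) ≤-refl (s≤s (s≤s z≤n)) refl
                        (cong (λ x → suc (suc x)) (+-comm N 2)))))
                (xor-same (e 2))
  last : e (3 + N) ≡ false
  last = trans (ref 1 1 (3 + N) (s≤s z≤n) ≤-refl (s≤s z≤n) refl) first

-- If moreover the generators vanish, then c = a_{1,2} = 0: for odd N the generator
-- (1, j_1) reads c directly, for even N the even weight of the palindromic row of odd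
-- length forces its middle entry c to vanish.
second-entry-zero : ∀ N j → Admissible (3 + N) j → ∀ X → DST (3 + N) X →
                    TakesValues (3 + N) j X (λ _ → false) → Framed N X →
                    ext (3 + N) X 2 ≡ false
second-entry-zero N j adm X (_ , ref , even) g (_ , constant , _) =
  bit-cases (isOdd N) odd-case even-case
  where
  e : ℕ → Bool
  e = ext (3 + N) X
  odd-case : isOdd N ≡ true → e 2 ≡ false
  odd-case o with first-generator N j adm o
  ... | present , row₁ , lower , upper =
    trans (sym (constant (j 1) lower upper))
          (subst (λ r → nabla X r (j r) ≡ false) row₁ (g 0 present))
  even-case : isOdd N ≡ false → e 2 ≡ false
  even-case o with middle-position N o
  ... | M , length , M≤N =
    trans (sym (constant (2 + M) (s≤s (s≤s z≤n)) (s≤s (s≤s M≤N))))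
      (trans (sym (rowSum-palindrome-odd e (3 + N) (suc M)
                     (refSym⇒palindrome (3 + N) (nabla X) ref) length))
             even)

DST₁-zero : ∀ X → DST 1 X → RowZero 1 X
DST₁-zero X (_ , _ , even) (suc zero) _ _ = even
DST₁-zero X _ (suc (suc t)) _ (s≤s ())

DST₂-zero : ∀ X → DST 2 X → RowZero 2 X
DST₂-zero X (rot , ref , _) = zero-row
  where
  mirror : ext 2 X 2 ≡ ext 2 X 1
  mirror = ref 1 1 2 (s≤s z≤n) ≤-refl (s≤s z≤n) refl
  -- rotation maps (2, 2) to (1, 1):  a_{1,1} = a_{1,1} ⊕ a_{1,2} = a_{1,1} ⊕ a_{1,1}
  first : ext 2 X 1 ≡ false
  first = trans (rot 2 2 1 1 (s≤s z≤n) ≤-refl ≤-refl refl refl)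
                (trans (cong (ext 2 X 1 xor_) mirror) (xor-same (ext 2 X 1)))
  zero-row : RowZero 2 X
  zero-row (suc zero)       _ _ = first
  zero-row (suc (suc zero)) _ _ = trans mirror first
  zero-row (suc (suc (suc t))) _ (s≤s (s≤s ()))

vanishing : ∀ n j → Admissible n j → ∀ X → DST n X → TakesValues n j X (λ _ → false) →
            RowZero n X
vanishing zero                j adm X dX g (suc t) _ ()
vanishing (suc zero)          j adm X dX g = DST₁-zero X dX
vanishing (suc (suc zero))    j adm X dX g = DST₂-zero X dX
vanishing (suc (suc (suc N))) j adm X dX g =
  framed-zero N X framed (second-entry-zero N j adm X dX g framed)
  where
  interior-values : TakesValues N (shrinkChoice j) (interior N X) (λ _ → false)
  interior-values k lt with generator-lift N k lt
  ... | k' , lt' , shifted =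
    trans (sym (generator-shift N j adm X (interior N X) (interior-spec N X) k k' lt shifted))
          (g k' lt')
  zero-interior : RowZero N (interior N X)
  zero-interior = vanishing N (shrinkChoice j) (admissible-interior N j adm) (interior N X)
                    (interior-DST N X (interior N X) (interior-spec N X) dX) interior-values
  framed : Framed N X
  framed = frame-row N X dX zero-interior

-- Surjectivity: lifting a triangle of DST(N) to DST(N + 3)

-- Given U ∈ DST(N) and a bit c, the row of length N + 3
--   L = 0, c ⊕ σ₀, c ⊕ σ₁, …, c ⊕ σ_N, 0        where σ_t = U_1 ⊕ … ⊕ U_t,
-- spans a rotation- and reflection-invariant triangle with interior U.
module Lift (N : ℕ) (U : Fin N → Bool) (dU : DST N U) (c : Bool) where

  private
    rotU : RotSym N (nabla U)
    rotU = proj₁ dU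
    refU : RefSym N (nabla U)
    refU = proj₁ (proj₂ dU)
    evenU : rowSum (ext N U) N ≡ false
    evenU = proj₂ (proj₂ dU)
    u : ℕ → Bool
    u = ext N U

  σ : ℕ → Bool
  σ = rowSum u

  liftRow : ℕ → Bool
  liftRow zero          = false
  liftRow (suc zero)    = false
  liftRow (suc (suc t)) with t ≤? N
  ... | yes _ = c xor σ t
  ... | no _  = false

  liftRow-inner : ∀ t → t ≤ N → liftRow (2 + t) ≡ c xor σ t
  liftRow-inner t le with t ≤? N
  ... | yes _  = refl
  ... | no t≰N = ⊥-elim (t≰N le)

  liftRow-last : liftRow (3 + N) ≡ false
  liftRow-last with suc N ≤? N
  ... | yes p = ⊥-elim (1+n≰n p)
  ... | no _  = refl

  lifted : Fin (3 + N) → Bool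
  lifted = row (3 + N) liftRow

  lifted-row : ∀ t → 1 ≤ t → t ≤ 3 + N → ext (3 + N) lifted t ≡ liftRow t
  lifted-row = ext-row (3 + N) liftRow

  -- Consecutive entries c ⊕ σ_{t-1} and c ⊕ σ_t differ by U_t.
  lifted-interior : HasInterior N lifted U
  lifted-interior = hasInterior N lifted U second-row
    where
    second-row : ∀ t → 1 ≤ t → t ≤ N → nabla lifted 2 (2 + t) ≡ u t
    second-row (suc t) _ le = begin
      ext (3 + N) lifted (2 + t) xor ext (3 + N) lifted (3 + t)
        ≡⟨ cong₂ _xor_ (lifted-row (2 + t) (s≤s z≤n) (s≤s (s≤s (≤-trans (n≤1+n t) (m≤n⇒m≤1+n le)))))
                       (lifted-row (3 + t) (s≤s z≤n) (s≤s (s≤s (m≤n⇒m≤1+n le)))) ⟩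
      liftRow (2 + t) xor liftRow (3 + t)
        ≡⟨ cong₂ _xor_ (liftRow-inner t (≤-trans (n≤1+n t) le)) (liftRow-inner (suc t) le) ⟩
      (c xor σ t) xor (c xor (σ t xor u (suc t)))
        ≡⟨ cong ((c xor σ t) xor_) (sym (xor-assoc c (σ t) (u (suc t)))) ⟩
      (c xor σ t) xor ((c xor σ t) xor u (suc t))
        ≡⟨ xor-cancelˡ (c xor σ t) (u (suc t)) ⟩
      u (suc t) ∎
      where open ≡-Reasoning

  -- Since U has a palindromic row of even weight, σ_t = σ_s whenever t + s = N.
  σ-symmetric : ∀ t s → t + s ≡ N → σ t ≡ σ s
  σ-symmetric t s e =
    xor-equal (trans (rowSum-palindrome-split u N (refSym⇒palindrome N (nabla U) refU) t s e) evenU)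

  liftRow-palindrome : Palindrome (3 + N) liftRow
  liftRow-palindrome (suc zero) b e _ _ = sym (trans (cong liftRow (suc-injective e)) liftRow-last)
  liftRow-palindrome (suc (suc t)) (suc zero) e _ _ =
    trans (cong liftRow (suc-injective (trans (sym (+1≡suc (2 + t))) e))) liftRow-last
  liftRow-palindrome (suc (suc t)) (suc (suc s)) e _ _ =
    trans (liftRow-inner t (m+n≤o⇒m≤o t (≤-reflexive t+s)))
      (trans (cong (c xor_) (σ-symmetric t s t+s))
             (sym (liftRow-inner s (m+n≤o⇒n≤o t (≤-reflexive t+s)))))
    where
    t+s : t + s ≡ N
    t+s = suc-injective (suc-injective
            (trans (sym (trans (+-suc t (suc s)) (cong suc (+-suc t s)))) (suc-injective (suc-injective e))))

  lifted-refSym : RefSym (3 + N) (nabla lifted)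
  lifted-refSym = refSym-from-palindrome (3 + N) (nabla lifted) (nabla-rule lifted) palindrome
    where
    palindrome : Palindrome (3 + N) (ext (3 + N) lifted)
    palindrome a b e a1 b1 =
      trans (lifted-row a a1 (summand≤ a b1 e))
        (trans (liftRow-palindrome a b e a1 b1)
               (sym (lifted-row b b1 (summand≤ b a1 (trans (+-comm b a) e)))))

  -- The last column agrees with the first row: a_{k,N+3} = L_k, using the rotation
  -- invariance of U along the way.
  lifted-column : ∀ k → 1 ≤ k → k ≤ 2 + N → nabla lifted k (3 + N) ≡ liftRow k
  lifted-column (suc zero) _ _ = trans (lifted-row (3 + N) (s≤s z≤n) ≤-refl) liftRow-last
  lifted-column (suc (suc zero)) _ _ = begin
    ext (3 + N) lifted (2 + N) xor ext (3 + N) lifted (3 + N)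
      ≡⟨ cong₂ _xor_ (lifted-row (2 + N) (s≤s z≤n) (n≤1+n _)) (lifted-row (3 + N) (s≤s z≤n) ≤-refl) ⟩
    liftRow (2 + N) xor liftRow (3 + N)
      ≡⟨ cong₂ _xor_ (trans (liftRow-inner N ≤-refl) (cong (c xor_) evenU)) liftRow-last ⟩
    (c xor false) xor false
      ≡⟨ xor-identityʳ (c xor false) ⟩
    c xor false ∎
    where open ≡-Reasoning
  lifted-column (suc (suc (suc m))) _ le = begin
    nabla lifted (2 + m) (2 + N) xor nabla lifted (2 + m) (3 + N)
      ≡⟨ cong₂ _xor_ (lifted-interior (suc m) N (s≤s z≤n) m<N ≤-refl)
                     (lifted-column (suc (suc m)) (s≤s z≤n) (≤-trans (n≤1+n _) le)) ⟩
    nabla U (suc m) N xor liftRow (2 + m)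
      ≡⟨ cong₂ _xor_ (rotU 1 (suc m) (suc m) N (s≤s z≤n) (s≤s z≤n) m<N (+1≡suc (suc m)) (+1≡suc N))
                     (liftRow-inner m (≤-trans (n≤1+n m) m<N)) ⟩
    u (suc m) xor (c xor σ m)
      ≡⟨ xor-comm (u (suc m)) (c xor σ m) ⟩
    (c xor σ m) xor u (suc m)
      ≡⟨ xor-assoc c (σ m) (u (suc m)) ⟩
    c xor σ (suc m)
      ≡⟨ sym (liftRow-inner (suc m) m<N) ⟩
    liftRow (3 + m) ∎
    where
    open ≡-Reasoning
    m<N : suc m ≤ N
    m<N = ≤-pred (≤-pred le)

  lifted-rotSym : RotSym (3 + N) (nabla lifted)
  lifted-rotSym = rotSym-from-edge (3 + N) (nabla lifted) (nabla-rule lifted) edge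
    where
    edge : ∀ k → 1 ≤ k → k ≤ 3 + N → nabla lifted k (3 + N) ≡ nabla lifted 1 k
    edge k k1 kn with m≤n⇒m<n∨m≡n kn
    ... | inj₁ lt   = trans (lifted-column k k1 (≤-pred lt)) (sym (lifted-row k k1 kn))
    -- the corner a_{N+3,N+3} = a_{N+2,N+2} ⊕ a_{N+2,N+3} vanishes by reflection
    ... | inj₂ refl =
      trans (trans (cong (nabla lifted (2 + N) (2 + N) xor_)
                         (lifted-refSym (2 + N) (2 + N) (3 + N) (s≤s z≤n) ≤-refl (n≤1+n _) refl))
                   (xor-same (nabla lifted (2 + N) (2 + N))))
            (sym (trans (lifted-row (3 + N) (s≤s z≤n) ≤-refl) liftRow-last))

  lifted-rowSum : rowSum (ext (3 + N) lifted) (3 + N) ≡ rowSum liftRow (3 + N)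
  lifted-rowSum = rowSum-cong _ _ (3 + N) lifted-row

Realisation : (n : ℕ) → (ℕ → ℕ) → (ℕ → Bool) → Set
Realisation n j f = Σ (Fin n → Bool) (λ S → DST n S × TakesValues n j S f)

-- For odd N, n = N + 3 is even, so every lift has a palindromic row of even length and
-- hence even weight; the new generator (1, j_1) reads c ⊕ σ_{j_1-2}, which fixes c.
lift-odd : ∀ N j → Admissible (3 + N) j → ∀ f → isOdd N ≡ true →
           Realisation N (shrinkChoice j) (λ k → f (suc k)) → Realisation (3 + N) j f
lift-odd N j adm f o (U , dU , values)
  with first-generator N j adm o
... | _ , row₁ , lower , upper = lifted , (lifted-rotSym , lifted-refSym , even) , values′
  where
  column : ∀ x → 2 ≤ x → x ≡ 2 + pred (pred x)
  column (suc (suc x)) _        = refl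
  column (suc zero)    (s≤s ())
  t₁ : ℕ
  t₁ = pred (pred (j 1))
  t₁≤N : t₁ ≤ N
  t₁≤N = ≤-pred (≤-pred (subst (_≤ 2 + N) (column (j 1) lower) upper))
  open Lift N U dU (f 0 xor rowSum (ext N U) t₁)
  even : rowSum (ext (3 + N) lifted) (3 + N) ≡ false
  even with even-half (3 + N) (trans (isOdd-3+ N) (cong not o))
  ... | M , length =
    trans lifted-rowSum (rowSum-palindrome-even liftRow (3 + N) M liftRow-palindrome length)
  values′ : TakesValues (3 + N) j lifted f
  values′ zero _ = subst (λ r → nabla lifted r (j r) ≡ f 0) (sym row₁)
    (trans (lifted-row (j 1) (≤-trans (s≤s z≤n) lower) (≤-trans upper (n≤1+n _)))
      (trans (cong liftRow (column (j 1) lower))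
        (trans (liftRow-inner t₁ t₁≤N) (xor-cancelʳ (f 0) (σ t₁)))))
  values′ (suc k) lt =
    trans (generator-shift N j adm lifted U lifted-interior k (suc k) lt′ (genRow-odd-suc N k o))
          (values k lt′)
    where
    lt′ : k < genCount N
    lt′ = ≤-pred (subst (suc k <_) (genCount-odd N o) lt)

-- For even N, n = N + 3 = 2M + 3 is odd and the row has even weight iff its middle
-- entry c ⊕ σ_M vanishes; this fixes c = σ_M, and no new generator appears.
lift-even : ∀ N j → Admissible (3 + N) j → ∀ f → isOdd N ≡ false →
            Realisation N (shrinkChoice j) f → Realisation (3 + N) j f
lift-even N j adm f o (U , dU , values)
  with middle-position N o
... | M , length , M≤N = lifted , (lifted-rotSym , lifted-refSym , even) , values′
  where
  open Lift N U dU (rowSum (ext N U) M)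
  even : rowSum (ext (3 + N) lifted) (3 + N) ≡ false
  even = trans lifted-rowSum
    (trans (rowSum-palindrome-odd liftRow (3 + N) (suc M) liftRow-palindrome length)
      (trans (liftRow-inner M M≤N) (xor-same (σ M))))
  values′ : TakesValues (3 + N) j lifted f
  values′ k lt =
    trans (generator-shift N j adm lifted U lifted-interior k k lt′ (genRow-even N k o)) (values k lt′)
    where
    lt′ : k < genCount N
    lt′ = subst (k <_) (genCount-even N o) lt

realise : ∀ n j → Admissible n j → ∀ f → Realisation n j f
realise zero                j adm f = zeroRow 0 , DST-zero 0 , λ k ()
realise (suc zero)          j adm f = zeroRow 1 , DST-zero 1 , λ k ()
realise (suc (suc zero))    j adm f = zeroRow 2 , DST-zero 2 , λ k ()
realise (suc (suc (suc N))) j adm f = bit-cases (isOdd N)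
  (λ o → lift-odd N j adm f o (realise N (shrinkChoice j) adm′ (λ k → f (suc k))))
  (λ o → lift-even N j adm f o (realise N (shrinkChoice j) adm′ f))
  where
  adm′ : Admissible N (shrinkChoice j)
  adm′ = admissible-interior N j adm

-- Matching the generators with G_{D_0}

genCount-6+ : ∀ n → genCount (6 + n) ≡ suc (genCount n)
genCount-6+ n with isOdd n
... | true  = refl
... | false = refl

isFour : ℕ → ℕ
isFour x with x ≟ 4
... | yes _ = 1
... | no _  = 0

delta-residue : ∀ n → delta 4 n 6 ≡ isFour (n % 6)
delta-residue n with n % 6 ≟ 4
... | yes _ = refl
... | no _  = refl

mD0-6+ : ∀ n → mD0 (6 + n) ≡ suc (mD0 n)
mD0-6+ n = cong₂ _+_ (m/n≡1+[m∸n]/n {6 + n} {6} (m≤m+n 6 n))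
  (trans (delta-residue (6 + n))
    (trans (cong isFour (trans (cong (_% 6) (+-comm 6 n)) ([m+n]%n≡m%n n 6))) (sym (delta-residue n))))

mD0≡genCount : ∀ n → mD0 n ≡ genCount n
mD0≡genCount 0 = refl
mD0≡genCount 1 = refl
mD0≡genCount 2 = refl
mD0≡genCount 3 = refl
mD0≡genCount 4 = refl
mD0≡genCount 5 = refl
mD0≡genCount (suc (suc (suc (suc (suc (suc n)))))) =
  trans (mD0-6+ n) (trans (cong suc (mD0≡genCount n)) (sym (genCount-6+ n)))

mod2≡isOdd : ∀ n → n % 2 ≡ (if isOdd n then 1 else 0)
mod2≡isOdd 0 = refl
mod2≡isOdd 1 = refl
mod2≡isOdd (suc (suc n)) =
  trans (cong (_% 2) (+-comm 2 n)) (trans ([m+n]%n≡m%n n 2) (trans (mod2≡isOdd n)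
    (cong (λ b → if b then 1 else 0) (sym (not-involutive (isOdd n))))))

generator : ℕ → (ℕ → ℕ) → ℕ → ℕ × ℕ
generator n j k = genRow n k , j (genRow n k)

GD0-generators : ∀ n j → GD0 n j ≡ applyUpTo (generator n j) (genCount n)
GD0-generators n j =
  trans (bit-cases (isOdd n) odd even) (cong (applyUpTo (generator n j)) (mD0≡genCount n))
  where
  odd : isOdd n ≡ true → GD0 n j ≡ applyUpTo (generator n j) (mD0 n)
  odd e rewrite mod2≡isOdd n | e = map-upTo _ (mD0 n)
  even : isOdd n ≡ false → GD0 n j ≡ applyUpTo (generator n j) (mD0 n)
  even e rewrite mod2≡isOdd n | e = map-upTo _ (mD0 n)

genRow-bound : ∀ n k → k < genCount n → 3 * genRow n k ≤ n
genRow-bound zero             k ()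
genRow-bound (suc zero)       k ()
genRow-bound (suc (suc zero)) k ()
genRow-bound (suc (suc (suc N))) k lt = bit-cases (isOdd N) (odd k lt) even
  where
  shifted : ∀ k r → k < genCount N → r ≡ suc (genRow N k) → 3 * r ≤ 3 + N
  shifted k r lt refl = subst (_≤ 3 + N) (sym (*-suc 3 (genRow N k)))
                          (+-monoʳ-≤ 3 (genRow-bound N k lt))
  odd : ∀ k → k < genCount (3 + N) → isOdd N ≡ true → 3 * genRow (3 + N) k ≤ 3 + N
  odd zero    _  o = subst (λ r → 3 * r ≤ 3 + N) (sym (genRow-odd-zero N o)) (m≤m+n 3 N)
  odd (suc k) lt o =
    shifted k _ (≤-pred (subst (suc k <_) (genCount-odd N o) lt)) (genRow-odd-suc N k o)
  even : isOdd N ≡ false → 3 * genRow (3 + N) k ≤ 3 + N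
  even o = shifted k _ (subst (k <_) (genCount-even N o) lt) (genRow-even N k o)

admissible : ∀ n j → (∀ i → 1 ≤ i → i ≤ n / 3 → 2 * i ≤ j i × j i ≤ n ∸ i) → Admissible n j
admissible n j hyp k lt = proj₁ bounds , m≤o∸n⇒m+n≤o (j r) r≤n (proj₂ bounds)
  where
  r : ℕ
  r = genRow n k
  r≤n : r ≤ n
  r≤n = ≤-trans (m≤m+n r _) (genRow-bound n k lt)
  r≤n/3 : r ≤ n / 3
  r≤n/3 = subst (_≤ n / 3) (m*n/n≡m r 3)
            (/-monoˡ-≤ 3 (subst (_≤ n) (*-comm 3 r) (genRow-bound n k lt)))
  bounds : 2 * r ≤ j r × j r ≤ n ∸ r
  bounds = hyp r (genRow-positive n k) r≤n/3

-- Distinct generators lie in distinct rows, so G_{D_0} has no repetitions.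
genRow-injective : ∀ n a b → genRow n a ≡ genRow n b → a ≡ b
genRow-injective n a b = bit-cases (isOdd n) odd even
  where
  odd : isOdd n ≡ true → genRow n a ≡ genRow n b → a ≡ b
  odd e rewrite e = λ q → +-cancelʳ-≡ 1 a b (*-cancelˡ-≡ (a + 1) (b + 1) 2 q)
  even : isOdd n ≡ false → genRow n a ≡ genRow n b → a ≡ b
  even e rewrite e = λ q → *-cancelˡ-≡ a b 2 (+-cancelʳ-≡ 1 (2 * a) (2 * b) q)

module Generating (n : ℕ) (j : ℕ → ℕ) (adm : Admissible n j) where

  G : List (ℕ × ℕ)
  G = applyUpTo (generator n j) (genCount n)

  valid : All (Valid n) G
  valid = applyUpTo⁺₁ (generator n j) (genCount n) λ {k} lt →
    let lower , upper = adm k lt in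
    genRow-positive n k , ≤-trans (m≤m+n (genRow n k) _) lower , m+n≤o⇒m≤o _ upper

  unique : Unique G
  unique = Unique.applyUpTo⁺₁ (generator n j) (genCount n)
    λ {a} {b} a<b _ same → <⇒≢ a<b (genRow-injective n a b (cong proj₁ same))

  -- Two members of DST₀(n) agreeing on G differ by a member vanishing on G, hence coincide.
  separating : ∀ S S' → InDST0 n S → InDST0 n S' →
               (∀ ij → ij ∈ G → nabla S (proj₁ ij) (proj₂ ij) ≡ nabla S' (proj₁ ij) (proj₂ ij)) →
               SameTriangle n S S'
  separating S S' inS inS' agree i k (i1 , ik , kn) =
    xor-equal (trans (sym (nabla-⊕ n S S' i k))
      (trans (rule-unique n (nabla (S ⊕ S')) (nabla (zeroRow n)) (nabla-rule _) (nabla-rule _)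
                (λ t t1 tn → trans (difference-zero t t1 tn) (sym (ext-zeroRow n t))) i k i1 ik kn)
             (nabla-zeroRow n i k)))
    where
    vanishes : TakesValues n j (S ⊕ S') (λ _ → false)
    vanishes k lt = trans (nabla-⊕ n S S' r (j r))
      (trans (cong (_xor nabla S' r (j r))
                   (agree (generator n j k) (∈-applyUpTo⁺ (generator n j) lt)))
             (xor-same (nabla S' r (j r))))
      where
      r : ℕ
      r = genRow n k
    difference-zero : RowZero n (S ⊕ S')
    difference-zero = vanishing n j adm (S ⊕ S')
                        (DST-⊕ n S S' (InDST0⇒DST n S inS) (InDST0⇒DST n S' inS')) vanishes

  spanning : ∀ (f : Fin (length G) → Bool) → ∃ λ S → InDST0 n S ×
             (∀ k → nabla S (proj₁ (lookup G k)) (proj₂ (lookup G k)) ≡ f k)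
  spanning f = S , DST⇒InDST0 n S inS , λ k →
    subst (λ ij → nabla S (proj₁ ij) (proj₂ ij) ≡ f k)
          (sym (lookup-applyUpTo (generator n j) (genCount n) k))
          (trans (values (toℕ k) (k<count k)) (extend-toℕ k))
    where
    -- f, extended by zero to all of ℕ
    extend : ℕ → Bool
    extend k with k <? length G
    ... | yes p = f (fromℕ< p)
    ... | no _  = false
    extend-toℕ : ∀ k → extend (toℕ k) ≡ f k
    extend-toℕ k with toℕ k <? length G
    ... | yes p  = cong f (fromℕ<-toℕ k p)
    ... | no k≮ = ⊥-elim (k≮ (toℕ<n k))
    realised : Realisation n j extend
    realised = realise n j adm extend
    S : Fin n → Bool
    S = proj₁ realised
    inS : DST n S
    inS = proj₁ (proj₂ realised)
    values : TakesValues n j S extend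
    values = proj₂ (proj₂ realised)
    k<count : ∀ (k : Fin (length G)) → toℕ k < genCount n
    k<count k = subst (toℕ k <_) (length-applyUpTo (generator n j) (genCount n)) (toℕ<n k)

  generating : IsGeneratingIndexSet n (InDST0 n) G
  generating = valid , unique , separating , spanning

mainTheorem9 : (n : ℕ) (j : ℕ → ℕ) →
    (∀ i → 1 ≤ i → i ≤ n / 3 → 2 * i ≤ j i × j i ≤ n ∸ i) →
    IsGeneratingIndexSet n (InDST0 n) (GD0 n j)
mainTheorem9 n j hyp =
  subst (IsGeneratingIndexSet n (InDST0 n)) (sym (GD0-generators n j))
        (Generating.generating n j (admissible n j hyp))
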